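{- (1) $\mathrm{sat}_{\mathsf c}(1,\ell)=0=\mathrm{ram}_{\mathsf c}(1,\ell)$ for every integer $\ell\ge 1$. (2) $\mathrm{sat}_{\mathsf c}(2,\ell)=1=\mathrm{ram}_{\mathsf c}(2,\ell)$ for every integer $\ell\ge 2$. (3) $\mathrm{sat}_{\mathsf c}(3,\ell)=\ell-1=\mathrm{ram}_{\mathsf c}(3,\ell)$ for every integer $\ell\ge 3$. (4) $\mathrm{sat}_{\mathsf c}(4,4)=6=\mathrm{ram}_{\mathsf c}(4,4)$.
   Context: A planar point set is generic if no three of its points are collinear and its points have pairwise distinct $x$-coordinates; a point $p$ is generic with respect to $P$ if $P\cup\{p\}$ is generic. For generic points $p_1,\dots,p_m$ in increasing order of $x$-coordinate, they form an $m$-cup (resp. $m$-cap) if the slopes of the lines $p_ip_{i+1}$, $1\le i<m$, are increasing (resp. decreasing). A generic set is $(k,\ell)$-cup-cap-free if it contains no $k$-cup and no $\ell$-cap; it is $(k,\ell)$-cup-cap-saturated if it is $(k,\ell)$-cup-cap-free and for every point $q\notin P$ generic with respect to $P$, $P\cup\{q\}$ contains a $k$-cup or an $\ell$-cap. $\mathrm{ram}_{\mathsf c}(k,\ell)$ is the maximum size of a $(k,\ell)$-cup-cap-free generic set and $\mathrm{sat}_{\mathsf c}(k,\ell)$ the minimum size of a $(k,\ell)$-cup-cap-saturated set.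
   Formalization: All points have rational coordinates, both the points of each planar point set and the added points $q$ in the saturation condition. -}

module Defs where

open import Data.Nat using (ℕ)
open import Data.Rational using (ℚ; 0ℚ; _-_; _*_; _÷_; _<_; _>_; ≢-nonZero)
open import Data.Rational.Properties using (_≟_)
open import Data.Product using (_×_; _,_; proj₁; proj₂; ∃)
open import Data.Sum using (_⊎_)
open import Data.Fin using (Fin)
open import Data.List using (List; []; _∷_; length; lookup)
open import Data.List.Relation.Unary.All using (All)
open import Data.List.Relation.Unary.Linked using (Linked)
open import Data.List.Membership.Propositional using (_∈_; _∉_)
open import Relation.Binary.PropositionalEquality using (_≡_; _≢_)
open import Relation.Nullary using (¬_; yes; no)

Point : Set
Point = ℚ × ℚ

xc : Point → ℚ
xc = proj₁

yc : Point → ℚ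
yc = proj₂

-- Slope of the line through p and q (only used when x-coordinates differ;
-- the dummy value 0 in the vertical case is never used).
slope : Point → Point → ℚ
slope p q with (xc q - xc p) ≟ 0ℚ
... | yes _ = 0ℚ
... | no ne = _÷_ (yc q - yc p) (xc q - xc p) {{≢-nonZero ne}}

Collinear : Point → Point → Point → Set
Collinear p q r = ((xc q - xc p) * (yc r - yc p)) ≡ ((yc q - yc p) * (xc r - xc p))

PointSet : Set
PointSet = List Point

Generic : PointSet → Set
Generic P =
  (∀ (i j : Fin (length P)) → i ≢ j → xc (lookup P i) ≢ xc (lookup P j)) ×
  (∀ (i j k : Fin (length P)) → i ≢ j → i ≢ k → j ≢ k →
     ¬ Collinear (lookup P i) (lookup P j) (lookup P k))

-- |P| (meaningful since a generic list has no repetitions)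
size : PointSet → ℕ
size = length

_<ₓ_ : Point → Point → Set
p <ₓ q = xc p < xc q

consecutiveSlopes : List Point → List ℚ
consecutiveSlopes [] = []
consecutiveSlopes (p ∷ []) = []
consecutiveSlopes (p ∷ q ∷ ps) = slope p q ∷ consecutiveSlopes (q ∷ ps)

IsCup : List Point → Set
IsCup ps = Linked _<ₓ_ ps × Linked _<_ (consecutiveSlopes ps)

IsCap : List Point → Set
IsCap ps = Linked _<ₓ_ ps × Linked _>_ (consecutiveSlopes ps)

HasCup : ℕ → PointSet → Set
HasCup m P = ∃ λ (ps : List Point) → length ps ≡ m × All (_∈ P) ps × IsCup ps

HasCap : ℕ → PointSet → Set
HasCap m P = ∃ λ (ps : List Point) → length ps ≡ m × All (_∈ P) ps × IsCap ps

CupCapFree : ℕ → ℕ → PointSet → Set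
CupCapFree k ℓ P = Generic P × ¬ HasCup k P × ¬ HasCap ℓ P

CupCapSaturated : ℕ → ℕ → PointSet → Set
CupCapSaturated k ℓ P =
  CupCapFree k ℓ P ×
  (∀ (q : Point) → q ∉ P → Generic (q ∷ P) → HasCup k (q ∷ P) ⊎ HasCap ℓ (q ∷ P))

RamC≡ : ℕ → ℕ → ℕ → Set
RamC≡ k ℓ n =
  (∃ λ P → CupCapFree k ℓ P × size P ≡ n) ×
  (∀ P → CupCapFree k ℓ P → size P Data.Nat.≤ n)

SatC≡ : ℕ → ℕ → ℕ → Set
SatC≡ k ℓ n =
  (∃ λ P → CupCapSaturated k ℓ P × size P ≡ n) ×
  (∀ P → CupCapSaturated k ℓ P → n Data.Nat.≤ size P)

{-# OPTIONS --safe #-}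

-- The upper bounds on ram_c come from the Erdős–Szekeres theorem for cups and caps: more than
-- (a + b choose a) generic points contain an (a + 2)-cup or a (b + 2)-cap. Split the points into
-- the left endpoints L of (a + 2)-cups and the rest R; R contains no (a + 2)-cup, and a
-- (b + 1)-cap in L ends where an (a + 2)-cup starts, so one of the two extends by a point.
-- A free set of that maximum size is then saturated, and sat_c = ram_c once every smaller free
-- set admits a new point. The new point is put very high or very low, so that every triple
-- through it with it at an end turns the same way and those with it in the middle the other
-- way. For k = 3 such a low point far to the left creates no 3-cup. For (4,4) and at most five
-- points it goes right of the second point: a new 4-cap (say, for a high point) is impossible,
-- and a new 4-cup would need a 3-cup among the at most three points to its right, which the
-- choice between high and low rules out.

module Submission where

open import Defs

open import Data.Empty using (⊥-elim)
open import Data.Fin using (Fin; zero; suc)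
import Data.Fin.Properties as Fin
open import Data.Integer using (ℤ; +_; -[1+_])
open import Data.List using (List; []; _∷_; _++_; length; lookup; map; filter; cartesianProductWith)
open import Data.List.Membership.Propositional using (_∈_; _∉_)
open import Data.List.Membership.Propositional.Properties
  using (∈-++⁺ˡ; ∈-++⁺ʳ; ∈-map⁺; ∈-cartesianProductWith⁺; ∈-filter⁻; ∈-lookup)
open import Data.List.Relation.Binary.Permutation.Propositional using (_↭_; ↭-refl; ↭-sym; ↭-trans; ↭-prep; ↭-swap)
open import Data.List.Relation.Binary.Permutation.Propositional.Properties using (All-resp-↭; ∈-resp-↭; ↭-length)
open import Data.List.Relation.Binary.Subset.Propositional using (_⊆_)
open import Data.List.Relation.Binary.Sublist.Propositional using ([]; _∷_; _∷ʳ_) renaming (_⊆_ to _⊑_)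
import Data.List.Relation.Binary.Sublist.Propositional as Sublist
import Data.List.Relation.Binary.Sublist.Propositional.Properties as Sublist
open import Data.List.Relation.Binary.Equality.Propositional using (≋⇒≡)
open import Data.List.Relation.Unary.All as All using (All; []; _∷_)
open import Data.List.Relation.Unary.AllPairs using (_∷_)
open import Data.List.Relation.Unary.Any as Any using (here; there)
open import Data.List.Relation.Unary.Any.Properties using (lookup-index)
open import Data.List.Relation.Unary.Linked as Linked using (Linked; []; [-]; _∷_)
import Data.List.Relation.Unary.Linked.Properties as Linked
import Data.List.Relation.Unary.All.Properties as All
open import Data.Nat as ℕ using (ℕ; zero; suc; z≤n; s≤s; _≤_; _∸_)
import Data.Nat.Properties as ℕ
open import Data.Product using (∃; ∃₂; _×_; _,_; proj₁; proj₂)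
open import Data.Rational as ℚ using (ℚ; 0ℚ; 1ℚ; _<_; _>_; _+_; _-_; _*_; _⊔_; _⊓_)
open import Data.Rational.Properties as ℚ using (_≟_; <-cmp; <-trans; <-asym; <-irrefl; <⇒≢; <-≤-trans; ≤-<-trans)
open import Data.Rational.Solver using (module +-*-Solver)
open import Algebra.Properties.Group ℚ.+-0-group using (x∙y⁻¹≈ε⇒x≈y)
open import Data.Sum as Sum using (_⊎_; inj₁; inj₂)
open import Function using (flip; _∘_)
open import Relation.Binary.Definitions using (Asymmetric; tri<; tri≈; tri>)
open import Relation.Binary.PropositionalEquality
open import Relation.Nullary using (¬_; Dec; yes; no; ¬?)
open import Relation.Nullary.Decidable using (map′; _×-dec_; _⊎-dec_; _→-dec_; from-yes; from-no)
open import Relation.Unary using (Decidable)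
open import Relation.Unary.Properties using (∁?)

open +-*-Solver using (solve; _:+_; _:*_; _:-_; _:=_)
open ≡-Reasoning

-- Slopes and collinearity

Δ≢0 : ∀ {a b} → a ≢ b → b - a ≢ 0ℚ
Δ≢0 a≢b b-a≡0 = a≢b (sym (x∙y⁻¹≈ε⇒x≈y _ _ b-a≡0))

*-cancelʳ : ∀ {a b d} → d ≢ 0ℚ → a * d ≡ b * d → a ≡ b
*-cancelʳ {a} {b} {d} d≢0 ad≡bd = begin
  a                ≡⟨ *-÷-cancel a ⟨
  a * d * ℚ.1/ d   ≡⟨ cong (_* ℚ.1/ d) ad≡bd ⟩
  b * d * ℚ.1/ d   ≡⟨ *-÷-cancel b ⟩
  b                ∎
  where
  instance _ = ℚ.≢-nonZero d≢0
  *-÷-cancel : ∀ x → x * d * ℚ.1/ d ≡ x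
  *-÷-cancel x = trans (ℚ.*-assoc x d _) (trans (cong (x *_) (ℚ.*-inverseʳ d)) (ℚ.*-identityʳ x))

slope-* : ∀ p q → xc p ≢ xc q → slope p q * (xc q - xc p) ≡ yc q - yc p
slope-* p q xp≢xq with (xc q - xc p) ≟ 0ℚ
... | yes Δx≡0 = ⊥-elim (Δ≢0 xp≢xq Δx≡0)
... | no Δx≢0 = begin
  Δy * ℚ.1/ Δx * Δx     ≡⟨ ℚ.*-assoc Δy (ℚ.1/ Δx) Δx ⟩
  Δy * (ℚ.1/ Δx * Δx)   ≡⟨ cong (Δy *_) (ℚ.*-inverseˡ Δx) ⟩
  Δy * 1ℚ               ≡⟨ ℚ.*-identityʳ Δy ⟩
  Δy                    ∎
  where
  Δx = xc q - xc p
  Δy = yc q - yc p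
  instance _ = ℚ.≢-nonZero Δx≢0

slope-unique : ∀ p q {s} → xc p ≢ xc q → s * (xc q - xc p) ≡ yc q - yc p → slope p q ≡ s
slope-unique p q xp≢xq s*Δx≡Δy =
  *-cancelʳ (Δ≢0 xp≢xq) (trans (slope-* p q xp≢xq) (sym s*Δx≡Δy))

collinear⇒slope≡ : ∀ {a b c} → xc a ≢ xc b → xc b ≢ xc c → Collinear a b c → slope a b ≡ slope b c
collinear⇒slope≡ {a} {b} {c} a≢b b≢c col = sym (slope-unique b c b≢c (begin
  s * (xc c - xc b)                      ≡⟨ solve 4 (λ s xa xb xc → s :* (xc :- xb) := s :* (xc :- xa) :- s :* (xb :- xa)) refl s (xc a) (xc b) (xc c) ⟩
  s * (xc c - xc a) - s * (xc b - xc a)  ≡⟨ cong₂ _-_ (sym Δy-ac) (slope-* a b a≢b) ⟩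
  (yc c - yc a) - (yc b - yc a)          ≡⟨ solve 3 (λ ya yb yc → (yc :- ya) :- (yb :- ya) := yc :- yb) refl (yc a) (yc b) (yc c) ⟩
  yc c - yc b                            ∎))
  where
  s = slope a b
  Δy-ac : yc c - yc a ≡ s * (xc c - xc a)
  Δy-ac = *-cancelʳ (Δ≢0 a≢b) (begin
    (yc c - yc a) * (xc b - xc a)          ≡⟨ ℚ.*-comm (yc c - yc a) (xc b - xc a) ⟩
    (xc b - xc a) * (yc c - yc a)          ≡⟨ col ⟩
    (yc b - yc a) * (xc c - xc a)          ≡⟨ cong (_* (xc c - xc a)) (slope-* a b a≢b) ⟨
    s * (xc b - xc a) * (xc c - xc a)      ≡⟨ solve 4 (λ s xa xb xc → s :* (xb :- xa) :* (xc :- xa) := s :* (xc :- xa) :* (xb :- xa)) refl s (xc a) (xc b) (xc c) ⟩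
    s * (xc c - xc a) * (xc b - xc a)      ∎)

slope≡⇒collinear : ∀ {a b c} → xc a ≢ xc b → xc b ≢ xc c → slope a b ≡ slope b c → Collinear a b c
slope≡⇒collinear {a} {b} {c} a≢b b≢c s≡t = begin
  (xc b - xc a) * (yc c - yc a)                            ≡⟨ cong ((xc b - xc a) *_) (solve 3 (λ ya yb yc → yc :- ya := (yc :- yb) :+ (yb :- ya)) refl (yc a) (yc b) (yc c)) ⟩
  (xc b - xc a) * ((yc c - yc b) + (yc b - yc a))         ≡⟨ cong₂ (λ u v → (xc b - xc a) * (u + v)) Δy-bc (slope-* a b a≢b) ⟨
  (xc b - xc a) * (s * (xc c - xc b) + s * (xc b - xc a)) ≡⟨ solve 4 (λ s xa xb xc → (xb :- xa) :* (s :* (xc :- xb) :+ s :* (xb :- xa)) := s :* (xb :- xa) :* (xc :- xa)) refl s (xc a) (xc b) (xc c) ⟩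
  s * (xc b - xc a) * (xc c - xc a)                         ≡⟨ cong (_* (xc c - xc a)) (slope-* a b a≢b) ⟩
  (yc b - yc a) * (xc c - xc a)                             ∎
  where
  s = slope a b
  Δy-bc : s * (xc c - xc b) ≡ yc c - yc b
  Δy-bc = subst (λ t → t * (xc c - xc b) ≡ yc c - yc b) (sym s≡t) (slope-* b c b≢c)

-- Both swaps negate the cross product, i.e. turn  L ≡ R  into  L′ ≡ R′  with  L′ - R′ ≡ R - L.
collinear-swap₁₂ : ∀ p q r → Collinear p q r → Collinear q p r
collinear-swap₁₂ p q r col = begin
  (xc p - xc q) * (yc r - yc q)   ≡⟨ solve 6 (λ xp xq xr yp yq yr → (xp :- xq) :* (yr :- yq) := (yp :- yq) :* (xr :- xq) :+ (yq :- yp) :* (xr :- xp) :- (xq :- xp) :* (yr :- yp)) refl (xc p) (xc q) (xc r) (yc p) (yc q) (yc r) ⟩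
  R′ + R - L                      ≡⟨ cong (λ z → R′ + R - z) col ⟩
  R′ + R - R                      ≡⟨ solve 2 (λ u v → u :+ v :- v := u) refl R′ R ⟩
  R′                              ∎
  where
  L = (xc q - xc p) * (yc r - yc p)
  R = (yc q - yc p) * (xc r - xc p)
  R′ = (yc p - yc q) * (xc r - xc q)

collinear-swap₂₃ : ∀ p q r → Collinear p q r → Collinear p r q
collinear-swap₂₃ p q r col = begin
  (xc r - xc p) * (yc q - yc p)   ≡⟨ solve 6 (λ xp xq xr yp yq yr → (xr :- xp) :* (yq :- yp) := (yr :- yp) :* (xq :- xp) :+ (yq :- yp) :* (xr :- xp) :- (xq :- xp) :* (yr :- yp)) refl (xc p) (xc q) (xc r) (yc p) (yc q) (yc r) ⟩
  R′ + R - L                      ≡⟨ cong (λ z → R′ + R - z) col ⟩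
  R′ + R - R                      ≡⟨ solve 2 (λ u v → u :+ v :- v := u) refl R′ R ⟩
  R′                              ∎
  where
  L = (xc q - xc p) * (yc r - yc p)
  R = (yc q - yc p) * (xc r - xc p)
  R′ = (yc r - yc p) * (xc q - xc p)

<-shift : ∀ d {p q p′ q′} → p + d ≡ p′ → q + d ≡ q′ → p < q → p′ < q′
<-shift d p+d≡p′ q+d≡q′ p<q = subst₂ _<_ p+d≡p′ q+d≡q′ (ℚ.+-monoˡ-< d p<q)

0<Δ : ∀ {x y} → x < y → 0ℚ < y - x
0<Δ {x} = <-shift (ℚ.- x) (ℚ.+-inverseʳ x) refl

Δ<0 : ∀ {x y} → x < y → x - y < 0ℚ
Δ<0 {y = y} = <-shift (ℚ.- y) refl (ℚ.+-inverseʳ y)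

s*Δx<Δy⇒s<slope : ∀ {u v s} → xc u < xc v → s * (xc v - xc u) < yc v - yc u → s < slope u v
s*Δx<Δy⇒s<slope {u} {v} {s} u<v s*Δx<Δy =
  ℚ.*-cancelʳ-<-nonNeg (xc v - xc u) {{ℚ.nonNegative (ℚ.<⇒≤ (0<Δ u<v))}}
    (subst (s * (xc v - xc u) <_) (sym (slope-* u v (<⇒≢ u<v))) s*Δx<Δy)

Δy<s*Δx⇒slope<s : ∀ {u v s} → xc u < xc v → yc v - yc u < s * (xc v - xc u) → slope u v < s
Δy<s*Δx⇒slope<s {u} {v} {s} u<v Δy<s*Δx =
  ℚ.*-cancelʳ-<-nonNeg (xc v - xc u) {{ℚ.nonNegative (ℚ.<⇒≤ (0<Δ u<v))}}
    (subst (_< s * (xc v - xc u)) (sym (slope-* u v (<⇒≢ u<v))) Δy<s*Δx)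

above-line-right : ∀ {u v s} → xc u < xc v → yc u + s * (xc v - xc u) < yc v → s < slope u v
above-line-right {u} {v} {s} u<v =
  s*Δx<Δy⇒s<slope u<v ∘ <-shift (ℚ.- yc u) (solve 3 (λ y s d → y :+ s :* d :- y := s :* d) refl (yc u) s (xc v - xc u)) refl

below-line-right : ∀ {u v s} → xc u < xc v → yc v < yc u + s * (xc v - xc u) → slope u v < s
below-line-right {u} {v} {s} u<v =
  Δy<s*Δx⇒slope<s u<v ∘ <-shift (ℚ.- yc u) refl (solve 3 (λ y s d → y :+ s :* d :- y := s :* d) refl (yc u) s (xc v - xc u))

above-line-left : ∀ {u v s} → xc v < xc u → yc u - s * (xc u - xc v) < yc v → slope v u < s
above-line-left {u} {v} {s} v<u =
  Δy<s*Δx⇒slope<s v<u ∘ <-shift (s * (xc u - xc v) - yc v)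
    (solve 3 (λ yu yv t → yu :- t :+ (t :- yv) := yu :- yv) refl (yc u) (yc v) (s * (xc u - xc v)))
    (solve 2 (λ yv t → yv :+ (t :- yv) := t) refl (yc v) (s * (xc u - xc v)))

below-line-left : ∀ {u v s} → xc v < xc u → yc v < yc u - s * (xc u - xc v) → s < slope v u
below-line-left {u} {v} {s} v<u =
  s*Δx<Δy⇒s<slope v<u ∘ <-shift (s * (xc u - xc v) - yc v)
    (solve 2 (λ yv t → yv :+ (t :- yv) := t) refl (yc v) (s * (xc u - xc v)))
    (solve 3 (λ yu yv t → yu :- t :+ (t :- yv) := yu :- yv) refl (yc u) (yc v) (s * (xc u - xc v)))

rising : ∀ {u v} → xc u < xc v → yc u < yc v → 0ℚ < slope u v
rising {u} {v} u<v yu<yv = s*Δx<Δy⇒s<slope u<v (subst (_< yc v - yc u) (sym (ℚ.*-zeroˡ (xc v - xc u))) (0<Δ yu<yv))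

falling : ∀ {u v} → xc u < xc v → yc v < yc u → slope u v < 0ℚ
falling {u} {v} u<v yv<yu = Δy<s*Δx⇒slope<s u<v (subst (yc v - yc u <_) (sym (ℚ.*-zeroˡ (xc v - xc u))) (Δ<0 yv<yu))

-- Generic sets and sorting by x-coordinate

<ₓ⇒≢ : ∀ {p q} → p <ₓ q → p ≢ q
<ₓ⇒≢ p<q refl = <-irrefl refl p<q

∈-tail : ∀ {q z : Point} {P} → q ≢ z → z ∈ q ∷ P → z ∈ P
∈-tail q≢z (here z≡q) = ⊥-elim (q≢z (sym z≡q))
∈-tail _   (there z∈P) = z∈P

fresh⇒∉ : ∀ {q P} → (∀ {a} → a ∈ P → xc a ≢ xc q) → q ∉ P
fresh⇒∉ fresh q∈P = fresh q∈P refl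

∈⇒lookup : ∀ {a : Point} {P} → a ∈ P → ∃ λ i → lookup P i ≡ a
∈⇒lookup a∈P = Any.index a∈P , sym (lookup-index a∈P)

generic[] : Generic []
generic[] = (λ ()) , (λ ())

generic⇒¬collinear : ∀ {P a b c} → Generic P → a ∈ P → b ∈ P → c ∈ P →
                     a ≢ b → a ≢ c → b ≢ c → ¬ Collinear a b c
generic⇒¬collinear {P} G a∈P b∈P c∈P a≢b a≢c b≢c with ∈⇒lookup a∈P | ∈⇒lookup b∈P | ∈⇒lookup c∈P
... | i , refl | j , refl | k , refl =
  proj₂ G i j k (a≢b ∘ cong (lookup P)) (a≢c ∘ cong (lookup P)) (b≢c ∘ cong (lookup P))

generic-tail : ∀ {p P} → Generic (p ∷ P) → Generic P
generic-tail (gx , gc) =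
  (λ i j i≢j → gx (suc i) (suc j) (i≢j ∘ Fin.suc-injective)) ,
  (λ i j k i≢j i≢k j≢k → gc (suc i) (suc j) (suc k) (i≢j ∘ Fin.suc-injective) (i≢k ∘ Fin.suc-injective) (j≢k ∘ Fin.suc-injective))

generic-head-fresh : ∀ {p P z} → Generic (p ∷ P) → z ∈ P → xc z ≢ xc p
generic-head-fresh {P = P} (gx , _) z∈P with ∈⇒lookup z∈P
... | i , refl = gx (suc i) zero (λ ())

generic-∷ : ∀ {q P} → Generic P → (∀ {a} → a ∈ P → xc a ≢ xc q) →
            (∀ {a b} → a ∈ P → b ∈ P → xc a ≢ xc b → ¬ Collinear q a b) → Generic (q ∷ P)
generic-∷ {q} {P} (gx , gc) fresh ¬col = gx′ , gc′
  where
  gx′ : ∀ (i j : Fin (length (q ∷ P))) → i ≢ j → xc (lookup (q ∷ P) i) ≢ xc (lookup (q ∷ P) j)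
  gx′ zero    zero    i≢j = ⊥-elim (i≢j refl)
  gx′ zero    (suc j) _   = fresh (∈-lookup j) ∘ sym
  gx′ (suc i) zero    _   = fresh (∈-lookup i)
  gx′ (suc i) (suc j) i≢j = gx i j (i≢j ∘ cong suc)
  ¬col′ : ∀ i j → i ≢ j → ¬ Collinear q (lookup P i) (lookup P j)
  ¬col′ i j i≢j = ¬col (∈-lookup i) (∈-lookup j) (gx i j i≢j)
  gc′ : ∀ (i j k : Fin (length (q ∷ P))) → i ≢ j → i ≢ k → j ≢ k →
        ¬ Collinear (lookup (q ∷ P) i) (lookup (q ∷ P) j) (lookup (q ∷ P) k)
  gc′ zero    zero    _       i≢j _   _   = ⊥-elim (i≢j refl)
  gc′ zero    (suc j) zero    _   i≢k _   = ⊥-elim (i≢k refl)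
  gc′ zero    (suc j) (suc k) _   _   j≢k = ¬col′ j k (j≢k ∘ cong suc)
  gc′ (suc i) zero    zero    _   _   j≢k = ⊥-elim (j≢k refl)
  gc′ (suc i) zero    (suc k) _   i≢k _   = ¬col′ i k (i≢k ∘ cong suc) ∘ collinear-swap₁₂ (lookup P i) q (lookup P k)
  gc′ (suc i) (suc j) zero    i≢j _   _   = ¬col′ i j (i≢j ∘ cong suc) ∘ collinear-swap₁₂ (lookup P i) q (lookup P j) ∘ collinear-swap₂₃ (lookup P i) (lookup P j) q
  gc′ (suc i) (suc j) (suc k) i≢j i≢k j≢k = gc i j k (i≢j ∘ cong suc) (i≢k ∘ cong suc) (j≢k ∘ cong suc)

generic? : ∀ P → Dec (Generic P)
generic? P =
  Fin.all? (λ i → Fin.all? λ j → ¬? (i Fin.≟ j) →-dec ¬? (xc (lookup P i) ≟ xc (lookup P j))) ×-dec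
  Fin.all? (λ i → Fin.all? λ j → Fin.all? λ k → ¬? (i Fin.≟ j) →-dec ¬? (i Fin.≟ k) →-dec ¬? (j Fin.≟ k) →-dec
            ¬? (_ ≟ _))

Sorted : List Point → Set
Sorted = Linked _<ₓ_

sorted-head : ∀ {p S} → Sorted (p ∷ S) → All (p <ₓ_) S
sorted-head sorted with Linked.Linked⇒AllPairs <-trans sorted
... | p<S ∷ _ = p<S

sorted-∷ : ∀ {p S} → All (p <ₓ_) S → Sorted S → Sorted (p ∷ S)
sorted-∷ []        []     = [-]
sorted-∷ (p<s ∷ _) sorted = p<s ∷ sorted

insert : ∀ p S → Sorted S → All (λ z → xc z ≢ xc p) S → ∃ λ S′ → Sorted S′ × S′ ↭ p ∷ S
insert p []      _      _ = p ∷ [] , [-] , ↭-refl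
insert p (s ∷ S) sorted (xs≢xp ∷ fresh) with <-cmp (xc p) (xc s)
... | tri< p<s _ _ = p ∷ s ∷ S , p<s ∷ sorted , ↭-refl
... | tri≈ _ xp≡xs _ = ⊥-elim (xs≢xp (sym xp≡xs))
... | tri> _ _ s<p with insert p S (Linked.tail sorted) fresh
...   | S′ , sorted′ , S′↭ =
  s ∷ S′ ,
  sorted-∷ (All-resp-↭ (↭-sym S′↭) (s<p ∷ sorted-head sorted)) sorted′ ,
  ↭-trans (↭-prep s S′↭) (↭-swap s p ↭-refl)

sort : ∀ P → Generic P → ∃ λ S → Sorted S × S ↭ P
sort []      _ = [] , [] , ↭-refl
sort (p ∷ P) G with sort P (generic-tail G)
... | S , sorted , S↭P with insert p S sorted (All-resp-↭ (↭-sym S↭P) (All.tabulate (generic-head-fresh G)))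
...   | S′ , sorted′ , S′↭ = S′ , sorted′ , ↭-trans S′↭ (↭-prep p S↭P)

sorted-⊑ : ∀ {S ps} → Sorted S → Sorted ps → All (_∈ S) ps → ps ⊑ S
sorted-⊑ {S} {[]} _ _ _ = Sublist.minimum S
sorted-⊑ {s ∷ S} {p ∷ ps} sorted-S sorted-ps (here refl ∷ ps∈) =
  refl ∷ sorted-⊑ (Linked.tail sorted-S) (Linked.tail sorted-ps)
                  (All.zipWith (λ (z∈ , p<z) → ∈-tail (<ₓ⇒≢ p<z) z∈) (ps∈ , sorted-head sorted-ps))
sorted-⊑ {s ∷ S} {p ∷ ps} sorted-S sorted-ps (there p∈S ∷ ps∈) =
  s ∷ʳ sorted-⊑ (Linked.tail sorted-S) sorted-ps
                (p∈S ∷ All.zipWith (λ (z∈ , p<z) → ∈-tail (<ₓ⇒≢ (<-trans s<p p<z)) z∈) (ps∈ , sorted-head sorted-ps))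
  where s<p = All.lookup (sorted-head sorted-S) p∈S

sorted-last₂ : ∀ ys {u c} → Sorted (ys ++ u ∷ c ∷ []) → u <ₓ c
sorted-last₂ []       (u<c ∷ _) = u<c
sorted-last₂ (_ ∷ ys) sorted    = sorted-last₂ ys (Linked.tail sorted)

-- Cups (≺ = _<_) and caps (≺ = _>_) as chains

Chain : (ℚ → ℚ → Set) → List Point → Set
Chain _≺_ ps = Sorted ps × Linked _≺_ (consecutiveSlopes ps)

HasChain : (ℚ → ℚ → Set) → ℕ → PointSet → Set
HasChain _≺_ m P = ∃ λ ps → length ps ≡ m × All (_∈ P) ps × Chain _≺_ ps

module _ {_≺_ : ℚ → ℚ → Set} where

  hasChain-mono : ∀ {m P Q} → P ⊆ Q → HasChain _≺_ m P → HasChain _≺_ m Q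
  hasChain-mono P⊆Q (ps , len , ps∈ , chain) = ps , len , All.map P⊆Q ps∈ , chain

  pair-chain : ∀ {u v T} → Sorted (u ∷ v ∷ T) → HasChain _≺_ 2 (u ∷ v ∷ T)
  pair-chain {u} {v} (u<v ∷ _) = u ∷ v ∷ [] , refl , here refl ∷ there (here refl) ∷ [] , (u<v ∷ [-]) , [-]

  chain-∷ : ∀ {x y z zs} → x <ₓ y → slope x y ≺ slope y z → Chain _≺_ (y ∷ z ∷ zs) → Chain _≺_ (x ∷ y ∷ z ∷ zs)
  chain-∷ x<y turn (sorted , turns) = x<y ∷ sorted , turn ∷ turns

  -- ys is matched two cells deep so that the slope lists on both sides expose their heads.
  chain-∷ʳ : ∀ ys {u c d} → Chain _≺_ (ys ++ u ∷ c ∷ []) → c <ₓ d → slope u c ≺ slope c d →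
             Chain _≺_ (ys ++ u ∷ c ∷ d ∷ [])
  chain-∷ʳ []                 (u<c ∷ [-] , [-])    c<d turn = u<c ∷ c<d ∷ [-] , turn ∷ [-]
  chain-∷ʳ (y ∷ [])           (y<u ∷ l , t ∷ ts)   c<d turn = chain-∷ y<u t (chain-∷ʳ [] (l , ts) c<d turn)
  chain-∷ʳ (y ∷ y′ ∷ [])      (y<y′ ∷ l , t ∷ ts)  c<d turn = chain-∷ y<y′ t (chain-∷ʳ (y′ ∷ []) (l , ts) c<d turn)
  chain-∷ʳ (y ∷ y′ ∷ y″ ∷ ys) (y<y′ ∷ l , t ∷ ts)  c<d turn = chain-∷ y<y′ t (chain-∷ʳ (y′ ∷ y″ ∷ ys) (l , ts) c<d turn)

  sorted-chain-length : ∀ {m S} → Sorted S → HasChain _≺_ m S → m ≤ length S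
  sorted-chain-length sorted (ps , refl , ps∈ , sorted-ps , _) = Sublist.length-mono-≤ (sorted-⊑ sorted sorted-ps ps∈)

  sorted-chain-whole : ∀ {S} → Sorted S → HasChain _≺_ (length S) S → Chain _≺_ S
  sorted-chain-whole sorted (ps , len , ps∈ , chain) with ≋⇒≡ (Sublist.to-≋ len (sorted-⊑ sorted (proj₁ chain) ps∈))
  ... | refl = chain

  chain-length : ∀ {m P} → Generic P → HasChain _≺_ m P → m ≤ size P
  chain-length {P = P} G has with sort P G
  ... | S , sorted , S↭P =
    subst (_ ≤_) (↭-length S↭P) (sorted-chain-length sorted (hasChain-mono (∈-resp-↭ (↭-sym S↭P)) has))

  short⇒¬chain : ∀ {m P} → Generic P → size P ℕ.< m → ¬ HasChain _≺_ m P
  short⇒¬chain G short has = ℕ.<⇒≱ short (chain-length G has)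

¬hasChain₃ : ∀ {_≺_ Q} → (∀ {a b c} → All (_∈ Q) (a ∷ b ∷ c ∷ []) → ¬ Chain _≺_ (a ∷ b ∷ c ∷ [])) →
             ¬ HasChain _≺_ 3 Q
¬hasChain₃ ¬chain (_ ∷ _ ∷ _ ∷ [] , refl , ps∈ , chain) = ¬chain ps∈ chain
¬hasChain₃ _ ([] , () , _)
¬hasChain₃ _ (_ ∷ [] , () , _)
¬hasChain₃ _ (_ ∷ _ ∷ [] , () , _)
¬hasChain₃ _ (_ ∷ _ ∷ _ ∷ _ ∷ _ , () , _)

¬hasChain₄ : ∀ {_≺_ Q} → (∀ {a b c d} → All (_∈ Q) (a ∷ b ∷ c ∷ d ∷ []) → ¬ Chain _≺_ (a ∷ b ∷ c ∷ d ∷ [])) →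
             ¬ HasChain _≺_ 4 Q
¬hasChain₄ ¬chain (_ ∷ _ ∷ _ ∷ _ ∷ [] , refl , ps∈ , chain) = ¬chain ps∈ chain
¬hasChain₄ _ ([] , () , _)
¬hasChain₄ _ (_ ∷ [] , () , _)
¬hasChain₄ _ (_ ∷ _ ∷ [] , () , _)
¬hasChain₄ _ (_ ∷ _ ∷ _ ∷ [] , () , _)
¬hasChain₄ _ (_ ∷ _ ∷ _ ∷ _ ∷ _ ∷ _ , () , _)

any-sublist? : ∀ {A : Set} {Q : List A → Set} → (∀ ps → Dec (Q ps)) → ∀ S → Dec (∃ λ ps → ps ⊑ S × Q ps)
any-sublist? Q? [] = map′ (λ q → [] , [] , q) (λ { (.[] , [] , q) → q }) (Q? [])
any-sublist? {Q = Q} Q? (s ∷ S) = map′ join split (any-sublist? Q? S ⊎-dec any-sublist? (Q? ∘ (s ∷_)) S)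
  where
  join : (∃ λ ps → ps ⊑ S × Q ps) ⊎ (∃ λ ps → ps ⊑ S × Q (s ∷ ps)) → ∃ λ ps → ps ⊑ s ∷ S × Q ps
  join (inj₁ (ps , τ , q)) = ps , s ∷ʳ τ , q
  join (inj₂ (ps , τ , q)) = s ∷ ps , refl ∷ τ , q
  split : (∃ λ ps → ps ⊑ s ∷ S × Q ps) → (∃ λ ps → ps ⊑ S × Q ps) ⊎ (∃ λ ps → ps ⊑ S × Q (s ∷ ps))
  split (ps , .s ∷ʳ τ , q)        = inj₁ (ps , τ , q)
  split (.s ∷ ps , refl ∷ τ , q) = inj₂ (ps , τ , q)

sorted-search? : ∀ {S} {Q : List Point → Set} → (∀ ps → Dec (Q ps)) → (∀ {ps} → Q ps → Sorted ps) →
                 Sorted S → Dec (∃ λ ps → All (_∈ S) ps × Q ps)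
sorted-search? Q? Q⇒sorted sorted =
  map′ (λ (ps , τ , q) → ps , All.tabulate (Sublist.lookup τ) , q)
       (λ (ps , ps∈ , q) → ps , sorted-⊑ sorted (Q⇒sorted q) ps∈ , q)
       (any-sublist? Q? _)

chain? : ∀ {_≺_ : ℚ → ℚ → Set} → (∀ x y → Dec (x ≺ y)) → ∀ ps → Dec (Chain _≺_ ps)
chain? ≺? ps = Linked.linked? (λ p q → xc p ℚ.<? xc q) ps ×-dec Linked.linked? ≺? (consecutiveSlopes ps)

hasChain? : ∀ {_≺_ : ℚ → ℚ → Set} {S} → (∀ x y → Dec (x ≺ y)) → ∀ m → Sorted S → Dec (HasChain _≺_ m S)
hasChain? ≺? m sorted =
  map′ (λ (ps , ps∈ , len , chain) → ps , len , ps∈ , chain)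
       (λ (ps , len , ps∈ , chain) → ps , ps∈ , len , chain)
       (sorted-search? (λ ps → (length ps ℕ.≟ m) ×-dec chain? ≺? ps) (proj₁ ∘ proj₂) sorted)

-- p itself need not lie in S, which keeps the predicate decidable without comparing points.
StartsCup : ℕ → PointSet → Point → Set
StartsCup m S p = ∃ λ ps → length (p ∷ ps) ≡ m × All (_∈ S) ps × IsCup (p ∷ ps)

startsCup? : ∀ m {S} → Sorted S → Decidable (StartsCup m S)
startsCup? m sorted p =
  map′ (λ (ps , ps∈ , len , cup) → ps , len , ps∈ , cup)
       (λ (ps , len , ps∈ , cup) → ps , ps∈ , len , cup)
       (sorted-search? (λ ps → (length (p ∷ ps) ℕ.≟ m) ×-dec chain? ℚ._<?_ (p ∷ ps)) (Linked.tail ∘ proj₁ ∘ proj₂) sorted)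

-- The Erdős–Szekeres theorem for cups and caps

SlopeGeneric : PointSet → Set
SlopeGeneric S = ∀ {a b c} → a ∈ S → b ∈ S → c ∈ S → a <ₓ b → b <ₓ c → slope a b ≢ slope b c

slopeGeneric-mono : ∀ {S P} → S ⊆ P → SlopeGeneric P → SlopeGeneric S
slopeGeneric-mono S⊆P gen a∈ b∈ c∈ = gen (S⊆P a∈) (S⊆P b∈) (S⊆P c∈)

generic⇒slopeGeneric : ∀ {P} → Generic P → SlopeGeneric P
generic⇒slopeGeneric G a∈ b∈ c∈ a<b b<c s≡t =
  generic⇒¬collinear G a∈ b∈ c∈ (<ₓ⇒≢ a<b) (<ₓ⇒≢ (<-trans a<b b<c)) (<ₓ⇒≢ b<c)
    (slope≡⇒collinear (<⇒≢ a<b) (<⇒≢ b<c) s≡t)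

orientation : ∀ {S a b c} → SlopeGeneric S → a ∈ S → b ∈ S → c ∈ S → a <ₓ b → b <ₓ c →
              slope a b < slope b c ⊎ slope a b > slope b c
orientation {a = a} {b} {c} gen a∈ b∈ c∈ a<b b<c with <-cmp (slope a b) (slope b c)
... | tri< cup _ _ = inj₁ cup
... | tri≈ _ s≡t _ = ⊥-elim (gen a∈ b∈ c∈ a<b b<c s≡t)
... | tri> _ _ cap = inj₂ cap

-- esBound a b is the binomial coefficient (a + b choose a).
esBound : ℕ → ℕ → ℕ
esBound zero    _       = 1
esBound (suc a) zero    = 1
esBound (suc a) (suc b) = esBound (suc a) b ℕ.+ esBound a (suc b)

esBound-1 : ∀ b → esBound 1 b ≡ suc b
esBound-1 zero    = refl
esBound-1 (suc b) = trans (ℕ.+-comm (esBound 1 b) 1) (cong suc (esBound-1 b))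

+-<-split : ∀ {x y l r} → x ℕ.+ y ℕ.< l ℕ.+ r → x ℕ.< l ⊎ y ℕ.< r
+-<-split {x} {y} {l} {r} x+y<l+r with x ℕ.<? l
... | yes x<l = inj₁ x<l
... | no x≮l  = inj₂ (ℕ.+-cancelˡ-< l y r (ℕ.≤-<-trans (ℕ.+-monoˡ-≤ y (ℕ.≮⇒≥ x≮l)) x+y<l+r))

length-filter-∁ : ∀ {A : Set} {Q : A → Set} (Q? : Decidable Q) xs →
                  length (filter Q? xs) ℕ.+ length (filter (∁? Q?) xs) ≡ length xs
length-filter-∁ Q? []       = refl
length-filter-∁ Q? (x ∷ xs) with Q? x
... | yes _ = cong suc (length-filter-∁ Q? xs)
... | no _  = trans (ℕ.+-suc _ _) (cong suc (length-filter-∁ Q? xs))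

ends-with-two : ∀ (xs : List Point) → 2 ≤ length xs → ∃₂ λ ys u → ∃ λ c → xs ≡ ys ++ u ∷ c ∷ []
ends-with-two (_ ∷ [])         (s≤s ())
ends-with-two (u ∷ c ∷ [])     _ = [] , u , c , refl
ends-with-two (x ∷ y ∷ z ∷ xs) _ with ends-with-two (y ∷ z ∷ xs) (s≤s (s≤s z≤n))
... | ys , u , c , eq = x ∷ ys , u , c , cong (x ∷_) eq

length-∷ʳ : ∀ (ys : List Point) {u c d} → length (ys ++ u ∷ c ∷ d ∷ []) ≡ suc (length (ys ++ u ∷ c ∷ []))
length-∷ʳ []       = refl
length-∷ʳ (_ ∷ ys) = cong suc (length-∷ʳ ys)

-- The turn at c decides: the cap continues to the cup's second point, or the cup extends
-- back to the cap's second-to-last point.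
cap-cup-join : ∀ {S m} → SlopeGeneric S → ∀ ys {u c} →
               All (_∈ S) (ys ++ u ∷ c ∷ []) → IsCap (ys ++ u ∷ c ∷ []) → StartsCup (suc (suc m)) S c →
               HasCup (suc (suc (suc m))) S ⊎ HasCap (suc (length (ys ++ u ∷ c ∷ []))) S
cap-cup-join gen ys {u} {c} cap∈ cap (d ∷ ds , len , d∈ ∷ ds∈ , cup@(c<d ∷ _ , _))
  with All.++⁻ʳ ys cap∈ | sorted-last₂ ys (proj₁ cap)
... | u∈ ∷ c∈ ∷ [] | u<c with orientation gen u∈ c∈ d∈ u<c c<d
...   | inj₁ ucd-cup = inj₁ (u ∷ c ∷ d ∷ ds , cong suc len , u∈ ∷ c∈ ∷ d∈ ∷ ds∈ , chain-∷ u<c ucd-cup cup)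
...   | inj₂ ucd-cap = inj₂ (ys ++ u ∷ c ∷ d ∷ [] , length-∷ʳ ys ,
                             All.++⁺ (All.++⁻ˡ ys cap∈) (u∈ ∷ c∈ ∷ d∈ ∷ []) , chain-∷ʳ ys cap c<d ucd-cap)

module _ {a b : ℕ} {S : PointSet} (sorted : Sorted S) (gen : SlopeGeneric S) where

  private
    starts? : Decidable (StartsCup (suc (suc a)) S)
    starts? = startsCup? (suc (suc a)) sorted

    L R : PointSet
    L = filter starts? S
    R = filter (∁? starts?) S

    L⊆S : L ⊆ S
    L⊆S z∈L = proj₁ (∈-filter⁻ starts? {xs = S} z∈L)

    R⊆S : R ⊆ S
    R⊆S z∈R = proj₁ (∈-filter⁻ (∁? starts?) {xs = S} z∈R)

    L-starts : ∀ {p} → p ∈ L → StartsCup (suc (suc a)) S p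
    L-starts p∈L = proj₂ (∈-filter⁻ starts? {xs = S} p∈L)

    R-¬starts : ∀ {p} → p ∈ R → ¬ StartsCup (suc (suc a)) S p
    R-¬starts p∈R = proj₂ (∈-filter⁻ (∁? starts?) {xs = S} p∈R)

  erdős–szekeres-step :
    (∀ {T} → Sorted T → SlopeGeneric T → esBound (suc a) b ℕ.< length T → HasCup (3 ℕ.+ a) T ⊎ HasCap (2 ℕ.+ b) T) →
    (∀ {T} → Sorted T → SlopeGeneric T → esBound a (suc b) ℕ.< length T → HasCup (2 ℕ.+ a) T ⊎ HasCap (3 ℕ.+ b) T) →
    esBound (suc a) (suc b) ℕ.< length S → HasCup (3 ℕ.+ a) S ⊎ HasCap (3 ℕ.+ b) S
  erdős–szekeres-step es-L es-R big
    with +-<-split (subst (esBound (suc a) (suc b) ℕ.<_) (sym (length-filter-∁ starts? S)) big)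
  ... | inj₁ L-big with es-L (Linked.filter⁺ starts? <-trans sorted) (slopeGeneric-mono L⊆S gen) L-big
  ...   | inj₁ cup = inj₁ (hasChain-mono L⊆S cup)
  ...   | inj₂ (xs , len , xs∈ , cap) with ends-with-two xs (subst (2 ≤_) (sym len) (s≤s (s≤s z≤n)))
  ...     | ys , u , c , refl =
    Sum.map₂ (subst (λ n → HasCap n S) (cong suc len))
      (cap-cup-join gen ys (All.map L⊆S xs∈) cap (L-starts (All.lookup xs∈ (∈-++⁺ʳ ys (there (here refl))))))
  erdős–szekeres-step es-L es-R big
      | inj₂ R-big with es-R (Linked.filter⁺ (∁? starts?) <-trans sorted) (slopeGeneric-mono R⊆S gen) R-big
  ...   | inj₁ (p ∷ ps , len , p∈ ∷ ps∈ , cup) = ⊥-elim (R-¬starts p∈ (ps , len , All.map R⊆S ps∈ , cup))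
  ...   | inj₂ cap = inj₂ (hasChain-mono R⊆S cap)

sorted-erdős–szekeres : ∀ a b {S} → Sorted S → SlopeGeneric S → esBound a b ℕ.< length S →
                        HasCup (2 ℕ.+ a) S ⊎ HasCap (2 ℕ.+ b) S
sorted-erdős–szekeres zero    b       {u ∷ v ∷ _} sorted _ _ = inj₁ (pair-chain sorted)
sorted-erdős–szekeres (suc a) zero    {u ∷ v ∷ _} sorted _ _ = inj₂ (pair-chain sorted)
sorted-erdős–szekeres (suc a) (suc b) sorted gen =
  erdős–szekeres-step sorted gen (sorted-erdős–szekeres (suc a) b) (sorted-erdős–szekeres a (suc b))
sorted-erdős–szekeres zero    b       {[]}    _ _ ()
sorted-erdős–szekeres zero    b       {_ ∷ []} _ _ (s≤s ())
sorted-erdős–szekeres (suc a) zero    {[]}    _ _ ()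
sorted-erdős–szekeres (suc a) zero    {_ ∷ []} _ _ (s≤s ())

erdős–szekeres : ∀ a b {P} → Generic P → esBound a b ℕ.< size P → HasCup (2 ℕ.+ a) P ⊎ HasCap (2 ℕ.+ b) P
erdős–szekeres a b {P} G big with sort P G
... | S , sorted , S↭P =
  Sum.map (hasChain-mono S⊆P) (hasChain-mono S⊆P)
    (sorted-erdős–szekeres a b sorted (slopeGeneric-mono S⊆P (generic⇒slopeGeneric G))
      (subst (esBound a b ℕ.<_) (sym (↭-length S↭P)) big))
  where
  S⊆P : S ⊆ P
  S⊆P = ∈-resp-↭ S↭P

-- Adding a point far above or below

-- q is ≺-beyond P if every triple of q ∷ P with q at an end is a ≺-chain and every triple
-- with q in the middle a reversed one; Above (q far above P) is the case ≺ = _<_.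
record Beyond (_≺_ : ℚ → ℚ → Set) (q : Point) (P : PointSet) : Set where
  field
    fresh  : ∀ {a} → a ∈ P → xc a ≢ xc q
    left   : ∀ {a b} → a ∈ P → b ∈ P → a <ₓ b → b <ₓ q → slope a b ≺ slope b q
    right  : ∀ {a b} → a ∈ P → b ∈ P → q <ₓ a → a <ₓ b → slope q a ≺ slope a b
    middle : ∀ {a b} → a ∈ P → b ∈ P → a <ₓ q → q <ₓ b → slope q b ≺ slope a q

Above Below : Point → PointSet → Set
Above = Beyond _<_
Below = Beyond _>_

>-asym : Asymmetric _>_
>-asym x>y y>x = <-asym x>y y>x

exceeds : ∀ vs → ∃ λ y → All (_< y) vs
exceeds []       = 0ℚ , []
exceeds (v ∷ vs) with exceeds vs
... | y , vs<y = (v + 1ℚ) ⊔ y ,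
  <-≤-trans v<v+1 (ℚ.p≤p⊔q (v + 1ℚ) y) ∷ All.map (λ w<y → <-≤-trans w<y (ℚ.p≤q⊔p (v + 1ℚ) y)) vs<y
  where v<v+1 = subst (_< v + 1ℚ) (ℚ.+-identityʳ v) (ℚ.+-monoʳ-< v (ℚ.positive⁻¹ 1ℚ))

undercuts : ∀ vs → ∃ λ y → All (y <_) vs
undercuts []       = 0ℚ , []
undercuts (v ∷ vs) with undercuts vs
... | y , y<vs = (v - 1ℚ) ⊓ y ,
  ≤-<-trans (ℚ.p⊓q≤p (v - 1ℚ) y) v-1<v ∷ All.map (≤-<-trans (ℚ.p⊓q≤q (v - 1ℚ) y)) y<vs
  where v-1<v = subst (v - 1ℚ <_) (ℚ.+-identityʳ v) (ℚ.+-monoʳ-< v (ℚ.negative⁻¹ (ℚ.- 1ℚ)))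

-- The last two lists both hold the heights at x of the lines through two points of P,
-- computed from one point or the other, as the two slope comparisons below need them.
heightsAt : ℚ → PointSet → List ℚ
heightsAt x P = map yc P ++ cartesianProductWith (λ a b → yc b + slope a b * (x - xc b)) P P
                         ++ cartesianProductWith (λ a b → yc a - slope a b * (xc a - x)) P P

module _ {x : ℚ} {P : PointSet} where

  height∈ : ∀ {a} → a ∈ P → yc a ∈ heightsAt x P
  height∈ a∈ = ∈-++⁺ˡ (∈-map⁺ yc a∈)

  lineʳ∈ : ∀ {a b} → a ∈ P → b ∈ P → yc b + slope a b * (x - xc b) ∈ heightsAt x P
  lineʳ∈ a∈ b∈ = ∈-++⁺ʳ (map yc P) (∈-++⁺ˡ (∈-cartesianProductWith⁺ (λ a b → yc b + slope a b * (x - xc b)) a∈ b∈))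

  lineˡ∈ : ∀ {a b} → a ∈ P → b ∈ P → yc a - slope a b * (xc a - x) ∈ heightsAt x P
  lineˡ∈ a∈ b∈ = ∈-++⁺ʳ (map yc P) (∈-++⁺ʳ _ (∈-cartesianProductWith⁺ (λ a b → yc a - slope a b * (xc a - x)) a∈ b∈))

above : ∀ P x → (∀ {a} → a ∈ P → xc a ≢ x) → ∃ λ y → Above (x , y) P
above P x fresh with exceeds (heightsAt x P)
... | y , <y = y , record
  { fresh  = fresh
  ; left   = λ a∈ b∈ _ b<q → above-line-right b<q (All.lookup <y (lineʳ∈ a∈ b∈))
  ; right  = λ a∈ b∈ q<a _ → above-line-left q<a (All.lookup <y (lineˡ∈ a∈ b∈))
  ; middle = λ a∈ b∈ a<q q<b → <-trans (falling q<b (All.lookup <y (height∈ b∈))) (rising a<q (All.lookup <y (height∈ a∈)))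
  }

below : ∀ P x → (∀ {a} → a ∈ P → xc a ≢ x) → ∃ λ y → Below (x , y) P
below P x fresh with undercuts (heightsAt x P)
... | y , y< = y , record
  { fresh  = fresh
  ; left   = λ a∈ b∈ _ b<q → below-line-right b<q (All.lookup y< (lineʳ∈ a∈ b∈))
  ; right  = λ a∈ b∈ q<a _ → below-line-left q<a (All.lookup y< (lineˡ∈ a∈ b∈))
  ; middle = λ a∈ b∈ a<q q<b → <-trans (falling a<q (All.lookup y< (height∈ a∈))) (rising q<b (All.lookup y< (height∈ b∈)))
  }

module _ {_≺_ : ℚ → ℚ → Set} (asym : Asymmetric _≺_) {q P} (beyond : Beyond _≺_ q P) where

  open Beyond beyond

  beyond-generic : Generic P → Generic (q ∷ P)
  beyond-generic G = generic-∷ G fresh ¬collinear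
    where
    ≺⇒≢ : ∀ {x y} → x ≺ y → x ≢ y
    ≺⇒≢ x≺y refl = asym x≺y x≺y
    ¬collinear-sorted : ∀ {a b} → a ∈ P → b ∈ P → a <ₓ b → ¬ Collinear q a b
    ¬collinear-sorted {a} {b} a∈ b∈ a<b col with <-cmp (xc q) (xc a) | <-cmp (xc q) (xc b)
    ... | tri≈ _ xq≡xa _ | _              = fresh a∈ (sym xq≡xa)
    ... | _              | tri≈ _ xq≡xb _ = fresh b∈ (sym xq≡xb)
    ... | tri< q<a _ _   | _              =
      ≺⇒≢ (right a∈ b∈ q<a a<b) (collinear⇒slope≡ (<⇒≢ q<a) (<⇒≢ a<b) col)
    ... | tri> _ _ a<q   | tri< q<b _ _   =
      ≺⇒≢ (middle a∈ b∈ a<q q<b) (sym (collinear⇒slope≡ (<⇒≢ a<q) (<⇒≢ q<b) (collinear-swap₁₂ q a b col)))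
    ... | tri> _ _ a<q   | tri> _ _ b<q   =
      ≺⇒≢ (left a∈ b∈ a<b b<q) (collinear⇒slope≡ (<⇒≢ a<b) (<⇒≢ b<q) (collinear-swap₂₃ a q b (collinear-swap₁₂ q a b col)))
    ¬collinear : ∀ {a b} → a ∈ P → b ∈ P → xc a ≢ xc b → ¬ Collinear q a b
    ¬collinear {a} {b} a∈ b∈ xa≢xb with <-cmp (xc a) (xc b)
    ... | tri< a<b _ _   = ¬collinear-sorted a∈ b∈ a<b
    ... | tri≈ _ xa≡xb _ = ⊥-elim (xa≢xb xa≡xb)
    ... | tri> _ _ b<a   = ¬collinear-sorted b∈ a∈ b<a ∘ collinear-swap₂₃ q a b

  -- In a 4-chain every point is an end of one of its two consecutive triples.
  beyond-¬reverse-4-chain : ¬ HasChain (flip _≺_) 4 P → ¬ HasChain (flip _≺_) 4 (q ∷ P)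
  beyond-¬reverse-4-chain ¬chain = ¬hasChain₄ λ where
    (here refl ∷ b∈ ∷ c∈ ∷ _ ∷ []) (q<b ∷ b<c ∷ _ , t ∷ _) →
      asym (right (∈-tail (<ₓ⇒≢ q<b) b∈) (∈-tail (<ₓ⇒≢ (<-trans q<b b<c)) c∈) q<b b<c) t
    (there _ ∷ here refl ∷ c∈ ∷ d∈ ∷ []) (_ ∷ q<c ∷ c<d ∷ [-] , _ ∷ t ∷ [-]) →
      asym (right (∈-tail (<ₓ⇒≢ q<c) c∈) (∈-tail (<ₓ⇒≢ (<-trans q<c c<d)) d∈) q<c c<d) t
    (there a∈ ∷ there b∈ ∷ here refl ∷ _ ∷ []) (a<b ∷ b<q ∷ _ , t ∷ _) →
      asym (left a∈ b∈ a<b b<q) t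
    (there _ ∷ there b∈ ∷ there c∈ ∷ here refl ∷ []) (_ ∷ b<c ∷ c<q ∷ [-] , _ ∷ t ∷ [-]) →
      asym (left b∈ c∈ b<c c<q) t
    (there a∈ ∷ there b∈ ∷ there c∈ ∷ there d∈ ∷ []) chain →
      ¬chain (_ , refl , a∈ ∷ b∈ ∷ c∈ ∷ d∈ ∷ [] , chain)

  -- q cannot be inside a ≺-chain (its triple would be reversed), so a new ≺-4-chain has q at
  -- an end and three points of P on one side of q.
  beyond-¬4-chain : ∀ {L R} → (∀ {z} → z ∈ P → z <ₓ q → z ∈ L) → ¬ HasChain _≺_ 3 L →
                    (∀ {z} → z ∈ P → q <ₓ z → z ∈ R) → ¬ HasChain _≺_ 3 R →
                    ¬ HasChain _≺_ 4 P → ¬ HasChain _≺_ 4 (q ∷ P)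
  beyond-¬4-chain toL ¬chainL toR ¬chainR ¬chain = ¬hasChain₄ λ where
    (here refl ∷ b∈ ∷ c∈ ∷ d∈ ∷ []) (q<b ∷ sorted@(b<c ∷ c<d ∷ [-]) , _ ∷ turns) →
      let q<c = <-trans q<b b<c
          q<d = <-trans q<c c<d
      in ¬chainR (_ , refl , toR (∈-tail (<ₓ⇒≢ q<b) b∈) q<b ∷ toR (∈-tail (<ₓ⇒≢ q<c) c∈) q<c
                             ∷ toR (∈-tail (<ₓ⇒≢ q<d) d∈) q<d ∷ [] , sorted , turns)
    (there a∈ ∷ here refl ∷ c∈ ∷ _ ∷ []) (a<q ∷ q<c ∷ _ , t ∷ _) →
      asym t (middle a∈ (∈-tail (<ₓ⇒≢ q<c) c∈) a<q q<c)
    (there _ ∷ there b∈ ∷ here refl ∷ d∈ ∷ []) (_ ∷ b<q ∷ q<d ∷ [-] , _ ∷ t ∷ [-]) →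
      asym t (middle b∈ (∈-tail (<ₓ⇒≢ q<d) d∈) b<q q<d)
    (there a∈ ∷ there b∈ ∷ there c∈ ∷ here refl ∷ []) (a<b ∷ b<c ∷ c<q ∷ [-] , t ∷ _ ∷ [-]) →
      let b<q = <-trans b<c c<q
          a<q = <-trans a<b b<q
      in ¬chainL (_ , refl , toL a∈ a<q ∷ toL b∈ b<q ∷ toL c∈ c<q ∷ [] , (a<b ∷ b<c ∷ [-]) , (t ∷ [-]))
    (there a∈ ∷ there b∈ ∷ there c∈ ∷ there d∈ ∷ []) chain →
      ¬chain (_ , refl , a∈ ∷ b∈ ∷ c∈ ∷ d∈ ∷ [] , chain)

  beyond-leftmost-¬reverse-3-chain : (∀ {z} → z ∈ P → q <ₓ z) →
                                     ¬ HasChain (flip _≺_) 3 P → ¬ HasChain (flip _≺_) 3 (q ∷ P)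
  beyond-leftmost-¬reverse-3-chain leftmost ¬chain = ¬hasChain₃ λ where
    (here refl ∷ b∈ ∷ c∈ ∷ []) (q<b ∷ b<c ∷ [-] , t ∷ [-]) →
      asym (right (∈-tail (<ₓ⇒≢ q<b) b∈) (∈-tail (<ₓ⇒≢ (<-trans q<b b<c)) c∈) q<b b<c) t
    (there a∈ ∷ b∈ ∷ c∈ ∷ []) chain@(a<b ∷ b<c ∷ [-] , _) →
      let q<b = <-trans (leftmost a∈) a<b
      in ¬chain (_ , refl , a∈ ∷ ∈-tail (<ₓ⇒≢ q<b) b∈ ∷ ∈-tail (<ₓ⇒≢ (<-trans q<b b<c)) c∈ ∷ [] , chain)

-- Extending small cup-cap-free sets

Extendable : ℕ → ℕ → PointSet → Set
Extendable k ℓ P = ∃ λ q → q ∉ P × CupCapFree k ℓ (q ∷ P)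

leftmost-below : ∀ P → ∃ λ q → Below q P × (∀ {z} → z ∈ P → q <ₓ z)
leftmost-below P = (x , proj₁ (below P x fresh)) , proj₂ (below P x fresh) , leftmost
  where
  x = proj₁ (undercuts (map xc P))
  leftmost : ∀ {a} → a ∈ P → x < xc a
  leftmost a∈ = All.lookup (proj₂ (undercuts (map xc P))) (∈-map⁺ xc a∈)
  fresh : ∀ {a} → a ∈ P → xc a ≢ x
  fresh a∈ xa≡x = <⇒≢ (leftmost a∈) (sym xa≡x)

extend-¬3-cup : ∀ {P} → Generic P → ¬ HasCup 3 P → ∃ λ q → q ∉ P × Generic (q ∷ P) × ¬ HasCup 3 (q ∷ P)
extend-¬3-cup {P} G ¬cup =
  q , fresh⇒∉ (Beyond.fresh B) , beyond-generic >-asym B G , beyond-leftmost-¬reverse-3-chain >-asym B leftmost ¬cup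
  where
  q = proj₁ (leftmost-below P)
  B = proj₁ (proj₂ (leftmost-below P))
  leftmost = proj₂ (proj₂ (leftmost-below P))

¬3-cup-set : ∀ n → ∃ λ P → Generic P × ¬ HasCup 3 P × size P ≡ n
¬3-cup-set zero = [] , generic[] , short⇒¬chain generic[] (s≤s z≤n) , refl
¬3-cup-set (suc n) =
  let P , G , ¬cup , |P|≡n = ¬3-cup-set n
      q , _ , G′ , ¬cup′ = extend-¬3-cup G ¬cup
  in q ∷ P , G′ , ¬cup′ , cong suc |P|≡n

few-extendable-4-4 : ∀ {P} → CupCapFree 4 4 P → size P ℕ.< 3 → Extendable 4 4 P
few-extendable-4-4 (G , _) few =
  let q , q∉ , G′ , _ = extend-¬3-cup G (short⇒¬chain G few)
  in q , q∉ , G′ , short⇒¬chain G′ (s≤s few) , short⇒¬chain G′ (s≤s few)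

-- The new point goes into the gap right of the second point, so only two points lie left of it.
module Gap {P s₀ s₁ s₂ R} (free : CupCapFree 4 4 P) (sorted : Sorted (s₀ ∷ s₁ ∷ s₂ ∷ R))
           (S↭P : s₀ ∷ s₁ ∷ s₂ ∷ R ↭ P) where

  private
    s₀<s₁ = Linked.head sorted
    s₁<s₂ = Linked.head (Linked.tail sorted)
    gap = ℚ.<-dense s₁<s₂
    x = proj₁ gap

    side : ∀ {z} → z ∈ P → z ∈ s₀ ∷ s₁ ∷ [] ⊎ z ∈ s₂ ∷ R
    side z∈ with ∈-resp-↭ (↭-sym S↭P) z∈
    ... | here z≡s₀         = inj₁ (here z≡s₀)
    ... | there (here z≡s₁) = inj₁ (there (here z≡s₁))
    ... | there (there z∈)  = inj₂ z∈

    left<x : ∀ {z} → z ∈ s₀ ∷ s₁ ∷ [] → xc z < x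
    left<x (here refl)         = <-trans s₀<s₁ (proj₁ (proj₂ gap))
    left<x (there (here refl)) = proj₁ (proj₂ gap)

    x<right : ∀ {z} → z ∈ s₂ ∷ R → x < xc z
    x<right (here refl) = proj₂ (proj₂ gap)
    x<right (there z∈R) = <-trans (proj₂ (proj₂ gap)) (All.lookup (sorted-head (Linked.tail (Linked.tail sorted))) z∈R)

    fresh : ∀ {z} → z ∈ P → xc z ≢ x
    fresh z∈ with side z∈
    ... | inj₁ z∈L = <⇒≢ (left<x z∈L)
    ... | inj₂ z∈R = λ xz≡x → <⇒≢ (x<right z∈R) (sym xz≡x)

    toL : ∀ {z} → z ∈ P → xc z < x → z ∈ s₀ ∷ s₁ ∷ []
    toL z∈ z<x with side z∈
    ... | inj₁ z∈L = z∈L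
    ... | inj₂ z∈R = ⊥-elim (<-asym z<x (x<right z∈R))

    toR : ∀ {z} → z ∈ P → x < xc z → z ∈ s₂ ∷ R
    toR z∈ x<z with side z∈
    ... | inj₁ z∈L = ⊥-elim (<-asym x<z (left<x z∈L))
    ... | inj₂ z∈R = z∈R

    ¬chainL : ∀ {_≺_} → ¬ HasChain _≺_ 3 (s₀ ∷ s₁ ∷ [])
    ¬chainL has = ℕ.<⇒≱ (ℕ.n<1+n 2) (sorted-chain-length (s₀<s₁ ∷ [-]) has)

  above-extends : ¬ HasCup 3 (s₂ ∷ R) → Extendable 4 4 P
  above-extends ¬cupR =
    let y , A = above P x fresh
        G , ¬cup , ¬cap = free
    in (x , y) , fresh⇒∉ fresh , beyond-generic <-asym A G ,
       beyond-¬4-chain <-asym A toL ¬chainL toR ¬cupR ¬cup , beyond-¬reverse-4-chain <-asym A ¬cap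

  below-extends : ¬ HasCap 3 (s₂ ∷ R) → Extendable 4 4 P
  below-extends ¬capR =
    let y , B = below P x fresh
        G , ¬cup , ¬cap = free
    in (x , y) , fresh⇒∉ fresh , beyond-generic >-asym B G ,
       beyond-¬reverse-4-chain >-asym B ¬cup , beyond-¬4-chain >-asym B toL ¬chainL toR ¬capR ¬cap

-- At most three points lie right of the gap; if they form a cup the new point goes below,
-- otherwise above.
gap-extendable-4-4 : ∀ {P s₀ s₁ s₂} R → CupCapFree 4 4 P → Sorted (s₀ ∷ s₁ ∷ s₂ ∷ R) →
                     s₀ ∷ s₁ ∷ s₂ ∷ R ↭ P → length R ≤ 2 → Extendable 4 4 P
gap-extendable-4-4 [] free sorted S↭P _ =
  Gap.above-extends free sorted S↭P λ has → ℕ.<⇒≱ (s≤s (s≤s z≤n)) (sorted-chain-length [-] has)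
gap-extendable-4-4 (_ ∷ []) free sorted S↭P _ =
  Gap.above-extends free sorted S↭P λ has → ℕ.<⇒≱ (ℕ.n<1+n 2) (sorted-chain-length (Linked.tail (Linked.tail sorted)) has)
gap-extendable-4-4 (_ ∷ _ ∷ []) free@(G , _) sorted@(_ ∷ _ ∷ sortedR) S↭P _ =
  Sum.[ (λ cup → Gap.below-extends free sorted S↭P λ has →
          <-asym cup (Linked.head (proj₂ (sorted-chain-whole sortedR has))))
      , (λ cap → Gap.above-extends free sorted S↭P λ has →
          <-asym cap (Linked.head (proj₂ (sorted-chain-whole sortedR has))))
      ]′ (orientation (slopeGeneric-mono (∈-resp-↭ S↭P) (generic⇒slopeGeneric G))
               (there (there (here refl))) (there (there (there (here refl)))) (there (there (there (there (here refl)))))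
               (Linked.head sortedR) (Linked.head (Linked.tail sortedR)))
gap-extendable-4-4 (_ ∷ _ ∷ _ ∷ _) _ _ _ (s≤s (s≤s ()))

extendable-4-4 : ∀ P → CupCapFree 4 4 P → size P ℕ.< 6 → Extendable 4 4 P
extendable-4-4 P free@(G , _) small with sort P G
... | [] , _ , S↭P =
  few-extendable-4-4 free (subst (ℕ._< 3) (↭-length S↭P) (s≤s z≤n))
... | _ ∷ [] , _ , S↭P =
  few-extendable-4-4 free (subst (ℕ._< 3) (↭-length S↭P) (s≤s (s≤s z≤n)))
... | _ ∷ _ ∷ [] , _ , S↭P =
  few-extendable-4-4 free (subst (ℕ._< 3) (↭-length S↭P) (s≤s (s≤s (s≤s z≤n))))
... | _ ∷ _ ∷ _ ∷ R , sorted , S↭P =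
  gap-extendable-4-4 R free sorted S↭P (ℕ.+-cancelˡ-≤ 4 (length R) 2 (subst (ℕ._< 6) (sym (↭-length S↭P)) small))

-- Saturation and Ramsey numbers

sat≡ram : ∀ {k ℓ n} P → CupCapFree k ℓ P → size P ≡ n →
          (∀ Q → Generic Q → n ℕ.< size Q → HasCup k Q ⊎ HasCap ℓ Q) →
          (∀ Q → CupCapFree k ℓ Q → size Q ℕ.< n → Extendable k ℓ Q) →
          SatC≡ k ℓ n × RamC≡ k ℓ n
sat≡ram {k} {ℓ} P free refl large⇒cup⊎cap small⇒extendable =
  ((P , (free , saturated) , refl) , minimal) , ((P , free , refl) , maximal)
  where
  saturated : ∀ q → q ∉ P → Generic (q ∷ P) → HasCup k (q ∷ P) ⊎ HasCap ℓ (q ∷ P)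
  saturated q _ G = large⇒cup⊎cap (q ∷ P) G ℕ.≤-refl
  maximal : ∀ Q → CupCapFree k ℓ Q → size Q ≤ size P
  maximal Q (G , ¬cup , ¬cap) = ℕ.≮⇒≥ λ large → Sum.[ ¬cup , ¬cap ]′ (large⇒cup⊎cap Q G large)
  minimal : ∀ Q → CupCapSaturated k ℓ Q → size P ≤ size Q
  minimal Q (free , saturated) = ℕ.≮⇒≥ λ small →
    let q , q∉ , G , ¬cup , ¬cap = small⇒extendable Q free small
    in Sum.[ ¬cup , ¬cap ]′ (saturated q q∉ G)

sat≡ram≡0 : ∀ ℓ → 1 ≤ ℓ → SatC≡ 1 ℓ 0 × RamC≡ 1 ℓ 0
sat≡ram≡0 ℓ 1≤ℓ = sat≡ram [] (generic[] , short⇒¬chain generic[] ℕ.≤-refl , short⇒¬chain generic[] 1≤ℓ) refl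
  (λ { (q ∷ _) _ _ → inj₁ (q ∷ [] , refl , here refl ∷ [] , [-] , []) })
  (λ _ _ ())

sat≡ram≡1 : ∀ ℓ → 2 ≤ ℓ → SatC≡ 2 ℓ 1 × RamC≡ 2 ℓ 1
sat≡ram≡1 (suc (suc b)) _ = sat≡ram (origin ∷ []) free refl (λ _ G → erdős–szekeres 0 b G) extend
  where
  origin : Point
  origin = 0ℚ , 0ℚ
  G : Generic (origin ∷ [])
  G = generic-∷ generic[] (λ ()) (λ ())
  free : CupCapFree 2 (2 ℕ.+ b) (origin ∷ [])
  free = G , short⇒¬chain G ℕ.≤-refl , short⇒¬chain G (s≤s (s≤s z≤n))
  extend : ∀ Q → CupCapFree 2 (2 ℕ.+ b) Q → size Q ℕ.< 1 → Extendable 2 (2 ℕ.+ b) Q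
  extend [] _ _ = origin , (λ ()) , free
  extend (_ ∷ _) _ (s≤s ())
sat≡ram≡1 (suc zero) (s≤s ())

sat≡ram≡ℓ-1 : ∀ ℓ → 3 ≤ ℓ → SatC≡ 3 ℓ (ℓ ∸ 1) × RamC≡ 3 ℓ (ℓ ∸ 1)
sat≡ram≡ℓ-1 (suc (suc (suc b))) _ =
  let P , G , ¬cup , |P| = ¬3-cup-set (2 ℕ.+ b)
  in sat≡ram P (G , ¬cup , short⇒¬chain G (subst (ℕ._< 3 ℕ.+ b) (sym |P|) ℕ.≤-refl)) |P| large small
  where
  large : ∀ Q → Generic Q → 2 ℕ.+ b ℕ.< size Q → HasCup 3 Q ⊎ HasCap (3 ℕ.+ b) Q
  large Q G big = erdős–szekeres 1 (suc b) G (subst (ℕ._< size Q) (sym (esBound-1 (suc b))) big)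
  small : ∀ Q → CupCapFree 3 (3 ℕ.+ b) Q → size Q ℕ.< 2 ℕ.+ b → Extendable 3 (3 ℕ.+ b) Q
  small Q (G , ¬cup , _) few =
    let q , q∉ , G′ , ¬cup′ = extend-¬3-cup G ¬cup
    in q , q∉ , G′ , ¬cup′ , short⇒¬chain G′ (s≤s few)
sat≡ram≡ℓ-1 (suc zero)       (s≤s ())
sat≡ram≡ℓ-1 (suc (suc zero)) (s≤s (s≤s ()))

sixPoints : PointSet
sixPoints = lattice (+ 0) -[1+ 0 ] ∷ lattice (+ 1) -[1+ 0 ] ∷ lattice (+ 2) -[1+ 1 ] ∷
    lattice (+ 3) (+ 1) ∷ lattice (+ 4) (+ 0) ∷ lattice (+ 5) (+ 0) ∷ []
  where
  lattice : ℤ → ℤ → Point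
  lattice x y = x ℚ./ 1 , y ℚ./ 1

sixPoints-free : CupCapFree 4 4 sixPoints
sixPoints-free = from-yes (generic? sixPoints) , from-no (hasChain? ℚ._<?_ 4 sorted) , from-no (hasChain? ℚ._>?_ 4 sorted)
  where
  sorted : Sorted sixPoints
  sorted = from-yes (Linked.linked? (λ p q → xc p ℚ.<? xc q) sixPoints)

sat≡ram≡6 : SatC≡ 4 4 6 × RamC≡ 4 4 6
sat≡ram≡6 = sat≡ram sixPoints sixPoints-free refl (λ _ G → erdős–szekeres 2 2 G) extendable-4-4

proposition9 : (∀ (ℓ : ℕ) → 1 ≤ ℓ → SatC≡ 1 ℓ 0 × RamC≡ 1 ℓ 0) ×
    (∀ (ℓ : ℕ) → 2 ≤ ℓ → SatC≡ 2 ℓ 1 × RamC≡ 2 ℓ 1) ×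
    (∀ (ℓ : ℕ) → 3 ≤ ℓ → SatC≡ 3 ℓ (ℓ ∸ 1) × RamC≡ 3 ℓ (ℓ ∸ 1)) ×
    (SatC≡ 4 4 6 × RamC≡ 4 4 6)
proposition9 = sat≡ram≡0 , sat≡ram≡1 , sat≡ram≡ℓ-1 , sat≡ram≡6
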